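{- Let $k\ge 3$ and let $H$ be an antiregular $k$-hypergraph with $n\ge k$ vertices. Then exactly $k$ vertices of $H$ share the same vertex-degree, and these are the only coincidences: the vertex-degrees of the remaining $n-k$ vertices are pairwise distinct and different from that common value.
   Context: A $k$-hypergraph has all hyperedges of size exactly $k$. An antiregular $k$-hypergraph on $n$ vertices is $H(b)$ on vertex set $\{1,\dots,n\}$ for a binary string $b=b_1\cdots b_n$ with $b_1=\dots=b_{k-1}=0$ and $b_k,\dots,b_n$ alternating (either $b_k=0$ or $b_k=1$), where $H(b)$ is obtained by adding the vertices $1,\dots,n$ in order, vertex $j$ being isolated (no new hyperedges) if $b_j=0$, and dominating if $b_j=1$, i.e. all sets $\{j\}\cup S$ with $S$ a $(k-1)$-subset of $\{1,\dots,j-1\}$ become hyperedges. The vertex-degree of a vertex is the number of hyperedges containing it. -}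

module Defs where

open import Relation.Binary.PropositionalEquality using (_≡_; _≢_)
open import Data.Bool using (Bool; true; false; if_then_else_)
open import Data.Nat using (ℕ; zero; suc; _∸_; _≟_; _≤_; _<_)
open import Data.List using (List; []; _∷_; _++_; map; concatMap; upTo; filter; length)
open import Data.List.Membership.DecPropositional _≟_ using (_∈?_)

range : ℕ → List ℕ
range n = map suc (upTo n)

choose : {A : Set} → ℕ → List A → List (List A)
choose zero    xs       = [] ∷ []
choose (suc m) []       = []
choose (suc m) (x ∷ xs) = map (x ∷_) (choose m xs) ++ choose (suc m) xs

-- Hyperedges of the k-hypergraph H(b) on vertices {1,…,n}: vertices j = 1..n are
-- added in order; if b j = true (dominating), every {j} ∪ S with S a
-- (k-1)-subset of {1,…,j-1} becomes a hyperedge; if b j = false, nothing is added.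
edges : (k n : ℕ) → (ℕ → Bool) → List (List ℕ)
edges k n b = concatMap (λ j → if b j then map (j ∷_) (choose (k ∸ 1) (range (j ∸ 1))) else []) (range n)

degree : (k n : ℕ) → (ℕ → Bool) → ℕ → ℕ
degree k n b v = length (filter (v ∈?_) (edges k n b))

-- b = b₁⋯bₙ (only indices 1..n matter) is an antiregular string for k:
-- b₁ = ⋯ = b_{k-1} = 0 and b_k, …, b_n alternate (b_k arbitrary).
record IsAntiregular (k n : ℕ) (b : ℕ → Bool) : Set where
  field
    initial-zero : ∀ i → 1 ≤ i → i < k → b i ≡ false
    alternating  : ∀ i → k ≤ i → suc i ≤ n → b (suc i) ≢ b i

-- When vertex j is added as a dominating vertex it gets degree C(j-1, k-1), and every earlier vertex
-- gains C(j-2, k-2); isolated vertices change nothing. For v < k only the gain of vertex k is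
-- nonzero, and it equals the arrival degree of k, so vertices 1, …, k share one degree.
-- A vertex w > k is compared with any u ≤ w - 2: if w is isolated, w - 1 was dominating and
-- gave u a positive gain that w never got; if w is dominating, the hockey-stick identity bounds
-- everything u collected before w below the arrival degree of w. Taking u = k - 1 separates the
-- degrees above k from the common one, and from each other.

module Submission where

open import Defs
open import Data.Bool using (Bool; true; false; if_then_else_; not)
open import Data.Bool.Properties using (¬-not)
open import Data.Empty using (⊥-elim)
open import Data.List using (List; []; _∷_; _++_; [_]; map; concatMap; upTo; filter; length)
open import Data.Nat using (ℕ; zero; suc; _+_; _∸_; _≤_; _<_; _≟_; _≤?_; z≤n; s≤s)
open import Data.List.Membership.DecPropositional _≟_ using (_∈?_)
open import Data.List.Membership.Propositional using (_∈_; _∉_)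
open import Data.List.Membership.Propositional.Properties using (∈-map⁺; ∈-map⁻; ∈-upTo⁺; ∈-upTo⁻)
open import Data.List.Properties
  using (length-++; length-map; filter-++; filter-accept; filter-reject; filter-all; concatMap-++; ++-identityʳ; map-++; upTo-∷ʳ; length-upTo)
open import Data.List.Relation.Unary.All as All using (All)
open import Data.List.Relation.Unary.All.Properties using (All¬⇒¬Any)
open import Data.List.Relation.Unary.Any using (here; there)
open import Data.List.Relation.Unary.Unique.Propositional using (Unique; _∷_)
open import Data.List.Relation.Unary.Unique.Propositional.Properties using (map⁺; upTo⁺)
open import Data.Nat.Combinatorics using (_C_; nCn≡1; nCk+nC[k+1]≡[n+1]C[k+1])
open import Data.Nat.Properties
open import Data.Product using (∃; _×_; _,_; proj₂; uncurry)
open import Data.Sum using (inj₁; inj₂)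
open import Function using (_∘_)
open import Level using (0ℓ)
open import Relation.Binary.Definitions using (tri<; tri≈; tri>)
open import Relation.Binary.PropositionalEquality hiding ([_])
open import Relation.Nullary using (Dec; yes; no; ¬_)
open import Relation.Unary using (Pred; Decidable)

length-filter-++ : ∀ {A : Set} {P : Pred A 0ℓ} (P? : Decidable P) xs ys →
  length (filter P? (xs ++ ys)) ≡ length (filter P? xs) + length (filter P? ys)
length-filter-++ P? xs ys = trans (cong length (filter-++ P? xs ys)) (length-++ (filter P? xs))

k≤n⇒nCk>0 : ∀ {n k} → k ≤ n → 0 < n C k
k≤n⇒nCk>0 {n} {zero} _ = s≤s z≤n
k≤n⇒nCk>0 {suc n} {suc k} (s≤s k≤n) =
  ≤-trans (k≤n⇒nCk>0 k≤n) (≤-trans (m≤m+n _ _) (≤-reflexive (nCk+nC[k+1]≡[n+1]C[k+1] n k)))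

nC[k+1]<[n+1]C[k+1] : ∀ {n k} → k ≤ n → n C suc k < suc n C suc k
nC[k+1]<[n+1]C[k+1] {n} {k} k≤n = begin-strict
  n C suc k             <⟨ +-monoˡ-< (n C suc k) (k≤n⇒nCk>0 k≤n) ⟩
  n C k + n C suc k     ≡⟨ nCk+nC[k+1]≡[n+1]C[k+1] n k ⟩
  suc n C suc k         ∎
  where open ≤-Reasoning

m≤n⇒∃[o]n≡o+m : ∀ {m n} → m ≤ n → ∃ λ o → n ≡ o + m
m≤n⇒∃[o]n≡o+m {m} {n} m≤n = n ∸ m , sym (m∸n+n≡m m≤n)

2+m≤n⇒∃[o]n≡2+o+m : ∀ {m n} → suc (suc m) ≤ n → ∃ λ o → n ≡ suc (suc o) + m
2+m≤n⇒∃[o]n≡2+o+m {m} 2+m≤n with o , refl ← m≤n⇒∃[o]n≡o+m 2+m≤n =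
  o , trans (+-suc o (suc m)) (cong suc (+-suc o m))

length-choose : ∀ {A : Set} m (xs : List A) → length (choose m xs) ≡ length xs C m
length-choose zero    xs       = refl
length-choose (suc m) []       = refl
length-choose (suc m) (x ∷ xs) = begin
  length (map (x ∷_) (choose m xs) ++ choose (suc m) xs)
    ≡⟨ length-++ (map (x ∷_) (choose m xs)) ⟩
  length (map (x ∷_) (choose m xs)) + length (choose (suc m) xs)
    ≡⟨ cong₂ _+_ (trans (length-map (x ∷_) (choose m xs)) (length-choose m xs)) (length-choose (suc m) xs) ⟩
  length xs C m + length xs C suc m
    ≡⟨ nCk+nC[k+1]≡[n+1]C[k+1] (length xs) m ⟩
  suc (length xs) C suc m ∎
  where open ≡-Reasoning

degreeIn : ℕ → List (List ℕ) → ℕ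
degreeIn v L = length (filter (v ∈?_) L)

degreeIn-++ : ∀ v L M → degreeIn v (L ++ M) ≡ degreeIn v L + degreeIn v M
degreeIn-++ v = length-filter-++ (v ∈?_)

degreeIn-map-∷-self : ∀ v L → degreeIn v (map (v ∷_) L) ≡ length L
degreeIn-map-∷-self v []      = refl
degreeIn-map-∷-self v (S ∷ L) =
  trans (cong length (filter-accept (v ∈?_) (here refl))) (cong suc (degreeIn-map-∷-self v L))

degreeIn-map-∷-other : ∀ {v j} → v ≢ j → ∀ L → degreeIn v (map (j ∷_) L) ≡ degreeIn v L
degreeIn-map-∷-other v≢j []      = refl
degreeIn-map-∷-other {v} {j} v≢j (S ∷ L) = by-cases (v ∈? S)
  where
  open ≡-Reasoning
  by-cases : Dec (v ∈ S) → degreeIn v (map (j ∷_) (S ∷ L)) ≡ degreeIn v (S ∷ L)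
  by-cases (yes v∈S) = begin
    degreeIn v (map (j ∷_) (S ∷ L))  ≡⟨ cong length (filter-accept (v ∈?_) (there v∈S)) ⟩
    suc (degreeIn v (map (j ∷_) L))  ≡⟨ cong suc (degreeIn-map-∷-other v≢j L) ⟩
    suc (degreeIn v L)               ≡⟨ cong length (filter-accept (v ∈?_) v∈S) ⟨
    degreeIn v (S ∷ L)               ∎
  by-cases (no v∉S) = begin
    degreeIn v (map (j ∷_) (S ∷ L))  ≡⟨ cong length (filter-reject (v ∈?_) {x = j ∷ S} λ { (here v≡j) → v≢j v≡j ; (there v∈S) → v∉S v∈S }) ⟩
    degreeIn v (map (j ∷_) L)        ≡⟨ degreeIn-map-∷-other v≢j L ⟩
    degreeIn v L                     ≡⟨ cong length (filter-reject (v ∈?_) v∉S) ⟨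
    degreeIn v (S ∷ L)               ∎

degreeIn-choose-∉ : ∀ {v xs} → v ∉ xs → ∀ m → degreeIn v (choose m xs) ≡ 0
degreeIn-choose-∉                v∉xs zero    = refl
degreeIn-choose-∉ {xs = []}      v∉xs (suc m) = refl
degreeIn-choose-∉ {v} {x ∷ xs}   v∉xs (suc m) = begin
  degreeIn v (map (x ∷_) (choose m xs) ++ choose (suc m) xs)
    ≡⟨ degreeIn-++ v (map (x ∷_) (choose m xs)) (choose (suc m) xs) ⟩
  degreeIn v (map (x ∷_) (choose m xs)) + degreeIn v (choose (suc m) xs)
    ≡⟨ cong₂ _+_ (degreeIn-map-∷-other (v∉xs ∘ here) (choose m xs)) (degreeIn-choose-∉ (v∉xs ∘ there) (suc m)) ⟩
  degreeIn v (choose m xs) + 0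
    ≡⟨ cong (_+ 0) (degreeIn-choose-∉ (v∉xs ∘ there) m) ⟩
  0 ∎
  where open ≡-Reasoning

degreeIn-choose-∈ : ∀ {v xs} → Unique xs → v ∈ xs → ∀ m → degreeIn v (choose (suc m) xs) ≡ (length xs ∸ 1) C m
degreeIn-choose-∈ {v} {v ∷ xs} (v∉xs ∷ _) (here refl) m = begin
  degreeIn v (map (v ∷_) (choose m xs) ++ choose (suc m) xs)
    ≡⟨ degreeIn-++ v (map (v ∷_) (choose m xs)) (choose (suc m) xs) ⟩
  degreeIn v (map (v ∷_) (choose m xs)) + degreeIn v (choose (suc m) xs)
    ≡⟨ cong₂ _+_ (degreeIn-map-∷-self v (choose m xs)) (degreeIn-choose-∉ (All¬⇒¬Any v∉xs) (suc m)) ⟩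
  length (choose m xs) + 0
    ≡⟨ trans (+-identityʳ _) (length-choose m xs) ⟩
  length xs C m ∎
  where open ≡-Reasoning
degreeIn-choose-∈ {v} {x ∷ y ∷ ys} (x∉ ∷ unique) (there v∈) m = begin
  degreeIn v (map (x ∷_) (choose m (y ∷ ys)) ++ choose (suc m) (y ∷ ys))
    ≡⟨ degreeIn-++ v (map (x ∷_) (choose m (y ∷ ys))) (choose (suc m) (y ∷ ys)) ⟩
  degreeIn v (map (x ∷_) (choose m (y ∷ ys))) + degreeIn v (choose (suc m) (y ∷ ys))
    ≡⟨ cong₂ _+_ (degreeIn-map-∷-other (λ v≡x → All.lookup x∉ v∈ (sym v≡x)) (choose m (y ∷ ys)))
                 (degreeIn-choose-∈ unique v∈ m) ⟩
  degreeIn v (choose m (y ∷ ys)) + length ys C m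
    ≡⟨ pascal m ⟩
  suc (length ys) C m ∎
  where
  open ≡-Reasoning
  pascal : ∀ m → degreeIn v (choose m (y ∷ ys)) + length ys C m ≡ suc (length ys) C m
  pascal zero     = refl
  pascal (suc m′) = trans (cong (_+ length ys C suc m′) (degreeIn-choose-∈ unique v∈ m′))
                          (nCk+nC[k+1]≡[n+1]C[k+1] (length ys) m′)

range-suc : ∀ n → range (suc n) ≡ range n ++ [ suc n ]
range-suc n = trans (cong (map suc) (sym (upTo-∷ʳ n))) (map-++ suc (upTo n) [ n ])

length-range : ∀ n → length (range n) ≡ n
length-range n = trans (length-map suc (upTo n)) (length-upTo n)

range-unique : ∀ n → Unique (range n)
range-unique n = map⁺ suc-injective (upTo⁺ n)

∈-range⁺ : ∀ {v n} → 1 ≤ v → v ≤ n → v ∈ range n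
∈-range⁺ {suc v} _ v<n = ∈-map⁺ suc (∈-upTo⁺ v<n)

∈-range⁻ : ∀ {v n} → v ∈ range n → 1 ≤ v × v ≤ n
∈-range⁻ v∈ with _ , i∈ , refl ← ∈-map⁻ suc v∈ = s≤s z≤n , ∈-upTo⁻ i∈

∉-range : ∀ {v n} → n < v → v ∉ range n
∉-range n<v v∈ = <⇒≱ n<v (proj₂ (∈-range⁻ v∈))

length-filter-range : ∀ {P : Pred ℕ 0ℓ} (P? : Decidable P) {k} n → k ≤ n →
  (∀ {v} → 1 ≤ v → v ≤ k → P v) → (∀ {v} → k < v → v ≤ n → ¬ P v) →
  length (filter P? (range n)) ≡ k
length-filter-range P? zero z≤n _ _ = refl
length-filter-range P? {k} (suc n) k≤1+n below above with m≤n⇒m<n∨m≡n k≤1+n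
... | inj₁ (s≤s k≤n) = begin
  length (filter P? (range (suc n)))
    ≡⟨ cong (length ∘ filter P?) (range-suc n) ⟩
  length (filter P? (range n ++ [ suc n ]))
    ≡⟨ length-filter-++ P? (range n) [ suc n ] ⟩
  length (filter P? (range n)) + length (filter P? [ suc n ])
    ≡⟨ cong₂ _+_ (length-filter-range P? n k≤n below (λ k<v v≤n → above k<v (m≤n⇒m≤1+n v≤n)))
                 (cong length (filter-reject P? (above (s≤s k≤n) ≤-refl))) ⟩
  k + 0
    ≡⟨ +-identityʳ k ⟩
  k ∎
  where open ≡-Reasoning
... | inj₂ refl = trans (cong length (filter-all P? (All.tabulate (λ v∈ → uncurry below (∈-range⁻ v∈)))))
                        (length-range (suc n))

module Degrees (r : ℕ) (b : ℕ → Bool) where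

  k : ℕ
  k = suc (suc r)

  block : ℕ → List (List ℕ)
  block j = if b j then map (j ∷_) (choose (suc r) (range (j ∸ 1))) else []

  arrival : ℕ → ℕ
  arrival v = if b v then (v ∸ 1) C suc r else 0

  gain : ℕ → ℕ
  gain j = if b j then (j ∸ 2) C r else 0

  gains : ℕ → ℕ → ℕ
  gains u zero    = 0
  gains u (suc d) = gains u d + gain (suc (d + u))

  arrival-isolated : ∀ {v} → b v ≡ false → arrival v ≡ 0
  arrival-isolated {v} bv = cong (λ β → if β then (v ∸ 1) C suc r else 0) bv

  arrival-dominating : ∀ {v} → b v ≡ true → arrival v ≡ (v ∸ 1) C suc r
  arrival-dominating {v} bv = cong (λ β → if β then (v ∸ 1) C suc r else 0) bv

  gain-isolated : ∀ {j} → b j ≡ false → gain j ≡ 0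
  gain-isolated {j} bj = cong (λ β → if β then (j ∸ 2) C r else 0) bj

  gain-dominating : ∀ {j} → b j ≡ true → gain j ≡ (j ∸ 2) C r
  gain-dominating {j} bj = cong (λ β → if β then (j ∸ 2) C r else 0) bj

  arrival≤ : ∀ v → arrival v ≤ (v ∸ 1) C suc r
  arrival≤ v with b v
  ... | true  = ≤-refl
  ... | false = z≤n

  gain≤ : ∀ j → gain j ≤ (j ∸ 2) C r
  gain≤ j with b j
  ... | true  = ≤-refl
  ... | false = z≤n

  edges-suc : ∀ n → edges k (suc n) b ≡ edges k n b ++ block (suc n)
  edges-suc n = begin
    concatMap block (range (suc n))              ≡⟨ cong (concatMap block) (range-suc n) ⟩
    concatMap block (range n ++ [ suc n ])       ≡⟨ concatMap-++ block (range n) [ suc n ] ⟩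
    edges k n b ++ (block (suc n) ++ [])         ≡⟨ cong (edges k n b ++_) (++-identityʳ (block (suc n))) ⟩
    edges k n b ++ block (suc n)                 ∎
    where open ≡-Reasoning

  degree-suc : ∀ n v → degree k (suc n) b v ≡ degree k n b v + degreeIn v (block (suc n))
  degree-suc n v = trans (cong (degreeIn v) (edges-suc n)) (degreeIn-++ v (edges k n b) (block (suc n)))

  degreeIn-block-self : ∀ j → degreeIn (suc j) (block (suc j)) ≡ arrival (suc j)
  degreeIn-block-self j with b (suc j)
  ... | true  = begin
    degreeIn (suc j) (map (suc j ∷_) (choose (suc r) (range j)))  ≡⟨ degreeIn-map-∷-self (suc j) (choose (suc r) (range j)) ⟩
    length (choose (suc r) (range j))                             ≡⟨ length-choose (suc r) (range j) ⟩
    length (range j) C suc r                                      ≡⟨ cong (_C suc r) (length-range j) ⟩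
    j C suc r                                                     ∎
    where open ≡-Reasoning
  ... | false = refl

  degreeIn-block-earlier : ∀ {v} j → 1 ≤ v → v ≤ j → degreeIn v (block (suc j)) ≡ gain (suc j)
  degreeIn-block-earlier {v} j 1≤v v≤j with b (suc j)
  ... | true  = begin
    degreeIn v (map (suc j ∷_) (choose (suc r) (range j)))  ≡⟨ degreeIn-map-∷-other (<⇒≢ (s≤s v≤j)) (choose (suc r) (range j)) ⟩
    degreeIn v (choose (suc r) (range j))                   ≡⟨ degreeIn-choose-∈ (range-unique j) (∈-range⁺ 1≤v v≤j) r ⟩
    (length (range j) ∸ 1) C r                              ≡⟨ cong (λ l → (l ∸ 1) C r) (length-range j) ⟩
    (j ∸ 1) C r                                             ∎
    where open ≡-Reasoning
  ... | false = refl

  degreeIn-block-later : ∀ {v} j → j < v → degreeIn v (block j) ≡ 0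
  degreeIn-block-later {v} j j<v with b j
  ... | true  = trans (degreeIn-map-∷-other (≢-sym (<⇒≢ j<v)) (choose (suc r) (range (j ∸ 1))))
                      (degreeIn-choose-∉ (∉-range (≤-<-trans (m∸n≤m j 1) j<v)) (suc r))
  ... | false = refl

  degree-before-arrival : ∀ {v} n → n < v → degree k n b v ≡ 0
  degree-before-arrival zero    _   = refl
  degree-before-arrival (suc n) n<v =
    trans (degree-suc n _) (cong₂ _+_ (degree-before-arrival n (<-trans (n<1+n n) n<v)) (degreeIn-block-later (suc n) n<v))

  degree-from-arrival : ∀ {v} d → 1 ≤ v → degree k (d + v) b v ≡ arrival v + gains v d
  degree-from-arrival {suc j} zero _ = begin
    degree k (suc j) b (suc j)                         ≡⟨ degree-suc j (suc j) ⟩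
    degree k j b (suc j) + degreeIn (suc j) (block (suc j))
      ≡⟨ cong₂ _+_ (degree-before-arrival j ≤-refl) (degreeIn-block-self j) ⟩
    arrival (suc j)                                    ≡⟨ +-identityʳ _ ⟨
    arrival (suc j) + 0                                ∎
    where open ≡-Reasoning
  degree-from-arrival {v} (suc d) 1≤v = begin
    degree k (suc (d + v)) b v                         ≡⟨ degree-suc (d + v) v ⟩
    degree k (d + v) b v + degreeIn v (block (suc (d + v)))
      ≡⟨ cong₂ _+_ (degree-from-arrival d 1≤v) (degreeIn-block-earlier (d + v) 1≤v (m≤n+m v d)) ⟩
    arrival v + gains v d + gain (suc (d + v))         ≡⟨ +-assoc (arrival v) _ _ ⟩
    arrival v + gains v (suc d)                        ∎
    where open ≡-Reasoning

  gains-+ : ∀ u e d → gains u (e + d) ≡ gains u d + gains (d + u) e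
  gains-+ u zero    d = sym (+-identityʳ _)
  gains-+ u (suc e) d = begin
    gains u (e + d) + gain (suc ((e + d) + u))            ≡⟨ cong₂ _+_ (gains-+ u e d) (cong (gain ∘ suc) (+-assoc e d u)) ⟩
    gains u d + gains (d + u) e + gain (suc (e + (d + u)))  ≡⟨ +-assoc (gains u d) _ _ ⟩
    gains u d + gains (d + u) (suc e)                     ∎
    where open ≡-Reasoning

  degree-split : ∀ {u} e d → 1 ≤ u → degree k (e + (d + u)) b u ≡ arrival u + gains u d + gains (d + u) e
  degree-split {u} e d 1≤u = begin
    degree k (e + (d + u)) b u              ≡⟨ cong (λ n → degree k n b u) (+-assoc e d u) ⟨
    degree k (e + d + u) b u                ≡⟨ degree-from-arrival (e + d) 1≤u ⟩
    arrival u + gains u (e + d)             ≡⟨ cong (arrival u +_) (gains-+ u e d) ⟩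
    arrival u + (gains u d + gains (d + u) e) ≡⟨ +-assoc (arrival u) _ _ ⟨
    arrival u + gains u d + gains (d + u) e ∎
    where open ≡-Reasoning

  -- the hockey-stick identity, as an inequality
  arrival+gains≤ : ∀ u d → arrival (suc u) + gains (suc u) d ≤ (d + u) C suc r
  arrival+gains≤ u zero    = ≤-trans (≤-reflexive (+-identityʳ _)) (arrival≤ (suc u))
  arrival+gains≤ u (suc d) = begin
    arrival (suc u) + (gains (suc u) d + gain (suc (d + suc u)))
      ≡⟨ +-assoc (arrival (suc u)) _ _ ⟨
    arrival (suc u) + gains (suc u) d + gain (suc (d + suc u))
      ≤⟨ +-mono-≤ (arrival+gains≤ u d) (subst (λ j → gain (suc j) ≤ (d + u) C r) (sym (+-suc d u)) (gain≤ (suc (suc (d + u))))) ⟩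
    (d + u) C suc r + (d + u) C r
      ≡⟨ +-comm ((d + u) C suc r) _ ⟩
    (d + u) C r + (d + u) C suc r
      ≡⟨ nCk+nC[k+1]≡[n+1]C[k+1] (d + u) r ⟩
    suc (d + u) C suc r ∎
    where open ≤-Reasoning

  -- u received the gain of the dominating vertex w - 1, which w missed; it is positive as w - 1 ≥ k.
  degree-isolated< : ∀ {u} d e → 1 ≤ u → k ≤ suc (d + u) →
    b (suc (d + u)) ≡ true → b (suc (suc d) + u) ≡ false →
    degree k (e + (suc (suc d) + u)) b (suc (suc d) + u) < degree k (e + (suc (suc d) + u)) b u
  degree-isolated< {u} d e 1≤u k≤w-1 bw-1 bw = begin-strict
    degree k (e + w) b w              ≡⟨ degree-from-arrival e (s≤s z≤n) ⟩
    arrival w + gains w e             ≡⟨ cong (_+ gains w e) (arrival-isolated bw) ⟩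
    0 + gains w e                     <⟨ +-monoˡ-< (gains w e) (≤-trans gain-pos gain≤total) ⟩
    arrival u + gains u (suc (suc d)) + gains w e ≡⟨ degree-split e (suc (suc d)) 1≤u ⟨
    degree k (e + w) b u              ∎
    where
    open ≤-Reasoning
    w : ℕ
    w = suc (suc d) + u
    gain-pos : 0 < gain (suc (d + u))
    gain-pos = subst (0 <_) (sym (gain-dominating bw-1)) (k≤n⇒nCk>0 (∸-monoˡ-≤ 1 (≤-pred k≤w-1)))
    gain≤total : gain (suc (d + u)) ≤ arrival u + gains u (suc (suc d))
    gain≤total = ≤-trans (m≤n+m _ (gains u d)) (≤-trans (m≤m+n _ (gain w)) (m≤n+m _ (arrival u)))

  -- Before w - 1, u had collected less than (w - 2) C (k - 1) (hockey stick); adding the gain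
  -- (w - 2) C (k - 2) from w keeps it below the arrival (w - 1) C (k - 1) of w (Pascal).
  degree-dominating> : ∀ {u} d e → 1 ≤ u → k < suc (suc d) + u →
    b (suc (d + u)) ≡ false → b (suc (suc d) + u) ≡ true →
    degree k (e + (suc (suc d) + u)) b u < degree k (e + (suc (suc d) + u)) b (suc (suc d) + u)
  degree-dominating> {suc u} d e 1≤u k<w bw-1 bw = begin-strict
    degree k (e + w) b (suc u)                                 ≡⟨ degree-split e (suc (suc d)) 1≤u ⟩
    arrival (suc u) + gains (suc u) (suc (suc d)) + gains w e  ≡⟨ cong (_+ gains w e) collected ⟩
    arrival (suc u) + gains (suc u) d + c + gains w e          <⟨ +-monoˡ-< (gains w e) (+-monoˡ-< c before<) ⟩
    (d + suc u) C suc r + c + gains w e                        ≡⟨ cong (_+ gains w e) (trans (+-comm _ c) (nCk+nC[k+1]≡[n+1]C[k+1] (d + suc u) r)) ⟩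
    suc (d + suc u) C suc r + gains w e                        ≡⟨ cong (_+ gains w e) (arrival-dominating bw) ⟨
    arrival w + gains w e                                      ≡⟨ degree-from-arrival e (s≤s z≤n) ⟨
    degree k (e + w) b w                                       ∎
    where
    open ≤-Reasoning
    w c : ℕ
    w = suc (suc d) + suc u
    c = (d + suc u) C r
    collected : arrival (suc u) + gains (suc u) (suc (suc d)) ≡ arrival (suc u) + gains (suc u) d + c
    collected = trans (cong (arrival (suc u) +_)
                        (cong₂ _+_ (trans (cong (gains (suc u) d +_) (gain-isolated bw-1)) (+-identityʳ _)) (gain-dominating bw)))
                      (sym (+-assoc (arrival (suc u)) _ _))
    before< : arrival (suc u) + gains (suc u) d < (d + suc u) C suc r
    before< = ≤-<-trans (arrival+gains≤ u d)
                (subst (λ m → (d + u) C suc r < m C suc r) (sym (+-suc d u))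
                  (nC[k+1]<[n+1]C[k+1] (≤-pred (subst (suc r ≤_) (+-suc d u) (≤-pred (≤-pred k<w))))))

module Antiregular (r : ℕ) (b : ℕ → Bool) {n} (antiregular : IsAntiregular (suc (suc r)) n b) where
  open Degrees r b
  open IsAntiregular antiregular

  deg : ℕ → ℕ
  deg = degree k n b

  flips : ∀ {i} → k ≤ i → suc i ≤ n → b i ≡ not (b (suc i))
  flips k≤i 1+i≤n = ¬-not (≢-sym (alternating _ k≤i 1+i≤n))

  degree-isolated-late : ∀ {u w} → 1 ≤ u → suc (suc u) ≤ w → k < w → w ≤ n → b w ≡ false → deg w < deg u
  degree-isolated-late {u} 1≤u 2+u≤w k<w w≤n bw
    with d , refl ← 2+m≤n⇒∃[o]n≡2+o+m 2+u≤w
       | e , refl ← m≤n⇒∃[o]n≡o+m w≤n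
    = degree-isolated< d e 1≤u (≤-pred k<w) (trans (flips (≤-pred k<w) w≤n) (cong not bw)) bw

  degree-dominating-late : ∀ {u w} → 1 ≤ u → suc (suc u) ≤ w → k < w → w ≤ n → b w ≡ true → deg u < deg w
  degree-dominating-late {u} 1≤u 2+u≤w k<w w≤n bw
    with d , refl ← 2+m≤n⇒∃[o]n≡2+o+m 2+u≤w
       | e , refl ← m≤n⇒∃[o]n≡o+m w≤n
    = degree-dominating> d e 1≤u k<w (trans (flips (≤-pred k<w) w≤n) (cong not bw)) bw

  degree-≢-late : ∀ {u w} → 1 ≤ u → suc (suc u) ≤ w → k < w → w ≤ n → deg u ≢ deg w
  degree-≢-late 1≤u 2+u≤w k<w w≤n with b _ in bw
  ... | false = ≢-sym (<⇒≢ (degree-isolated-late 1≤u 2+u≤w k<w w≤n bw))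
  ... | true  = <⇒≢ (degree-dominating-late 1≤u 2+u≤w k<w w≤n bw)

  gain≡arrival : ∀ {v} → 1 ≤ v → v ≤ k → gain v ≡ arrival v
  gain≡arrival {v} 1≤v v≤k with m≤n⇒m<n∨m≡n v≤k
  ... | inj₁ v<k  = trans (gain-isolated (initial-zero v 1≤v v<k)) (sym (arrival-isolated (initial-zero v 1≤v v<k)))
  ... | inj₂ refl = cong (λ c → if b k then c else 0) (trans (nCn≡1 r) (sym (nCn≡1 (suc r))))

  degree-step-up-to-k : ∀ {v} → 1 ≤ v → suc v ≤ k → suc v ≤ n → deg v ≡ deg (suc v)
  degree-step-up-to-k {v} 1≤v 1+v≤k 1+v≤n with e , refl ← m≤n⇒∃[o]n≡o+m 1+v≤n = begin
    deg v                                        ≡⟨ degree-split e 1 1≤v ⟩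
    arrival v + gain (suc v) + gains (suc v) e   ≡⟨ cong (_+ gains (suc v) e) (cong₂ _+_ (arrival-isolated (initial-zero v 1≤v 1+v≤k)) (gain≡arrival (s≤s z≤n) 1+v≤k)) ⟩
    arrival (suc v) + gains (suc v) e            ≡⟨ degree-from-arrival e (s≤s z≤n) ⟨
    deg (suc v)                                  ∎
    where open ≡-Reasoning

  degree-up-to-k : ∀ {v} → 1 ≤ v → v ≤ k → k ≤ n → deg v ≡ deg k
  degree-up-to-k {v} 1≤v v≤k k≤n = walk (k ∸ v) 1≤v (m∸n+n≡m v≤k)
    where
    walk : ∀ t {v} → 1 ≤ v → t + v ≡ k → deg v ≡ deg k
    walk zero    _   refl    = refl
    walk (suc t) {v} 1≤v t+v≡k =
      trans (degree-step-up-to-k 1≤v 1+v≤k (≤-trans 1+v≤k k≤n)) (walk t (s≤s z≤n) (trans (+-suc t v) t+v≡k))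
      where
      1+v≤k : suc v ≤ k
      1+v≤k = subst (suc v ≤_) t+v≡k (s≤s (m≤n+m v t))

  degree≢degree-k : ∀ {v} → k < v → v ≤ n → deg v ≢ deg k
  degree≢degree-k k<v v≤n deg-v≡deg-k =
    degree-≢-late (s≤s z≤n) k<v k<v v≤n (trans (degree-up-to-k (s≤s z≤n) (n≤1+n _) k≤n) (sym deg-v≡deg-k))
    where
    k≤n : k ≤ n
    k≤n = ≤-trans (n≤1+n k) (≤-trans k<v v≤n)

  -- Of two consecutive vertices above k one is isolated and the other dominating, so the degree of k - 1 separates them.
  degree-≢-next : ∀ {u} → k < u → suc u ≤ n → deg u ≢ deg (suc u)
  degree-≢-next {u} k<u 1+u≤n = by-cases (b (suc u)) refl
    where
    u≤n : u ≤ n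
    u≤n = ≤-trans (n≤1+n u) 1+u≤n
    k<1+u : k < suc u
    k<1+u = m≤n⇒m≤1+n k<u
    bu : b u ≡ not (b (suc u))
    bu = flips (<⇒≤ k<u) 1+u≤n
    by-cases : ∀ β → b (suc u) ≡ β → deg u ≢ deg (suc u)
    by-cases false b1+u = ≢-sym (<⇒≢ (<-trans (degree-isolated-late (s≤s z≤n) k<1+u k<1+u 1+u≤n b1+u)
                                              (degree-dominating-late (s≤s z≤n) k<u k<u u≤n (trans bu (cong not b1+u)))))
    by-cases true  b1+u = <⇒≢ (<-trans (degree-isolated-late (s≤s z≤n) k<u k<u u≤n (trans bu (cong not b1+u)))
                                      (degree-dominating-late (s≤s z≤n) k<1+u k<1+u 1+u≤n b1+u))

  degrees-distinct-after-k : ∀ {u w} → k < u → u < w → w ≤ n → deg u ≢ deg w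
  degrees-distinct-after-k {u} k<u u<w w≤n with m≤n⇒m<n∨m≡n u<w
  ... | inj₁ 2+u≤w = degree-≢-late (≤-trans (s≤s z≤n) k<u) 2+u≤w (<-trans k<u u<w) w≤n
  ... | inj₂ refl  = degree-≢-next k<u w≤n

  same-degree⇒degree-k : k ≤ n → ∀ {u v} → u ∈ range n → v ∈ range n → u ≢ v → deg u ≡ deg v → deg u ≡ deg k
  same-degree⇒degree-k k≤n {u} {v} u∈ v∈ u≢v deg-u≡deg-v
    with 1≤u , u≤n ← ∈-range⁻ u∈ | 1≤v , v≤n ← ∈-range⁻ v∈ | u ≤? k | v ≤? k
  ... | yes u≤k | _       = degree-up-to-k 1≤u u≤k k≤n
  ... | no _    | yes v≤k = trans deg-u≡deg-v (degree-up-to-k 1≤v v≤k k≤n)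
  ... | no u≰k  | no v≰k  with <-cmp u v
  ...   | tri< u<v _ _ = ⊥-elim (degrees-distinct-after-k (≰⇒> u≰k) u<v v≤n deg-u≡deg-v)
  ...   | tri≈ _ u≡v _ = ⊥-elim (u≢v u≡v)
  ...   | tri> _ _ v<u = ⊥-elim (degrees-distinct-after-k (≰⇒> v≰k) v<u u≤n (sym deg-u≡deg-v))

  count-degree-k : k ≤ n → length (filter (λ v → deg v ≟ deg k) (range n)) ≡ k
  count-degree-k k≤n = length-filter-range (λ v → deg v ≟ deg k) n k≤n
                         (λ 1≤v v≤k → degree-up-to-k 1≤v v≤k k≤n) degree≢degree-k

proposition1p2 : (k n : ℕ) (b : ℕ → Bool) → 3 ≤ k → k ≤ n → IsAntiregular k n b →
    ∃ λ d →
      length (filter (λ v → degree k n b v ≟ d) (range n)) ≡ k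
      × (∀ u v → u ∈ range n → v ∈ range n → u ≢ v →
           degree k n b u ≡ degree k n b v → degree k n b u ≡ d)
proposition1p2 k@(suc (suc r)) n b (s≤s (s≤s _)) k≤n antiregular =
  deg k , count-degree-k k≤n , λ u v → same-degree⇒degree-k k≤n
  where open Antiregular r b antiregular
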